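{- Let $h$ be the morphism on $\{a,b\}^*$ given by $h(a)=aab$, $h(b)=b$, and let $\mathbf z=h^\omega(a)=\lim_{n\to\infty}h^n(a)=aabaabbaabaabbb\cdots$ be its infinite fixed point starting with $a$. For every $n\ge 0$, $$\rho_{\mathbf z}(n)=\sum_{0\le i\le n}\min(2^i,\,n-i+1).$$
   Context: For an infinite word $\mathbf a=a_0a_1a_2\cdots$, a factor is a finite block $a_ia_{i+1}\cdots a_j$ (possibly empty). The subword complexity $\rho_{\mathbf a}(n)$ is the number of distinct factors of $\mathbf a$ of length $n$. $h^0(a)=a$ and $h^n(a)=h(h^{n-1}(a))$. -}

module Defs where

open import Data.Nat using (ℕ; zero; suc; _+_; _∸_; _^_; _⊓_; _<_)
open import Data.List using (List; []; _∷_; _++_; concatMap; length; map; upTo)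
open import Data.Nat.ListAction using (sum)
open import Data.Vec using (Vec; lookup)
open import Data.Fin using (Fin; toℕ)
open import Data.Product using (Σ; ∃; _×_)
open import Data.List.Membership.Propositional using (_∈_)
open import Data.List.Relation.Unary.Unique.Propositional using (Unique)
open import Relation.Binary.PropositionalEquality using (_≡_)
open import Function.Bundles using (_⇔_)

data AB : Set where
  a b : AB

hLetter : AB → List AB
hLetter a = a ∷ a ∷ b ∷ []
hLetter b = b ∷ []

h : List AB → List AB
h = concatMap hLetter

hPow : ℕ → List AB → List AB
hPow zero    w = w
hPow (suc n) w = h (hPow n w)

-- i-th letter of a finite word (default b if out of range; never used
-- out of range below, since |h^(i+1)(a)| = 2^(i+2) - 1 > i)
nth : List AB → ℕ → AB
nth []      _       = b
nth (x ∷ _) zero    = x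
nth (_ ∷ w) (suc i) = nth w i

-- The fixed point z = h^ω(a) = lim h^n(a): since each h^n(a) is a prefix
-- of h^(n+1)(a), the i-th letter of z is the i-th letter of h^(i+1)(a).
z : ℕ → AB
z i = nth (hPow (suc i) (a ∷ [])) i

IsFactor : (ℕ → AB) → (n : ℕ) → Vec AB n → Set
IsFactor x n w = ∃ λ i → (j : Fin n) → lookup w j ≡ x (i + toℕ j)

Complexity : (ℕ → AB) → ℕ → ℕ → Set
Complexity x n k =
  Σ (List (Vec AB n)) λ L →
    Unique L × length L ≡ k × ((w : Vec AB n) → (w ∈ L) ⇔ IsFactor x n w)

formula : ℕ → ℕ
formula n = sum (map (λ i → (2 ^ i) ⊓ (n ∸ i + 1)) (upTo (suc n)))

module Submission where

-- Let U_m = h^m(a), so U_0 = a and U_(m+1) = U_m U_m b: |U_m| = 2^(m+1) - 1, U_m ends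
-- in b^m and is a prefix of z. A factor of z of length n is a factor of the periodic
-- word U_n^ω and conversely, so ρ_z(n) counts the length-n windows of U_n^ω. For m ≤ ℓ
-- the number of length-ℓ windows of U_m^ω is Σ_{i ≤ m} min(2^i, ℓ - i + 1), by induction
-- on m: suitably aligned, U_(m+1)^ω agrees with U_m^ω on m + 2|U_m| letters and then has
-- the run b^(m+1), which never occurs in U_m^ω. If ℓ ≤ |U_m| + m + 1 this adds the ℓ - m
-- windows meeting that run to the old ones; for longer ℓ the windows of U_(m+1)^ω
-- determine their position modulo |U_(m+1)|, so there are 2^(m+2) - 1 of them.

open import Defs
open import Data.Nat using (ℕ; zero; suc; _+_; _*_; _∸_; _^_; _⊓_; _<_; _≤_; z≤n; s≤s; NonZero; _<?_; _≤?_; _/_; _%_)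
open import Data.Nat.Properties
open import Data.Nat.DivMod
open import Data.List using (List; []; _∷_; _++_; _∷ʳ_; length; map; upTo; applyUpTo)
open import Data.List.Properties using (length-++; concatMap-++; length-map; map-++; upTo-∷ʳ; length-applyUpTo)
open import Data.Nat.ListAction using (sum)
open import Data.Nat.ListAction.Properties using (sum-++)
open import Function using (_∘_)
open import Function.Bundles using (mk⇔)
open import Data.Vec using (Vec; lookup; tabulate)
open import Data.Vec.Properties using (lookup∘tabulate; tabulate∘lookup; tabulate-cong)
open import Data.Fin using (toℕ; fromℕ<)
open import Data.Fin.Properties using (toℕ<n; toℕ-fromℕ<)
open import Data.List.Relation.Unary.All as All using (All)
open import Data.List.Relation.Unary.Any as Any using (Any; here)
import Data.List.Relation.Unary.Any.Properties as AnyP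
open import Data.List.Relation.Unary.AllPairs as AP using (AllPairs)
import Data.List.Relation.Unary.AllPairs.Properties as APP
open import Data.List.Membership.Propositional using (_∈_)
open import Data.List.Membership.Propositional.Properties using (∈-map⁻; ∈-applyUpTo⁻)
open import Data.Product using (∃; _×_; _,_)
open import Data.Sum using (inj₁; inj₂)
open import Relation.Nullary using (¬_; yes; no)
open import Relation.Binary.PropositionalEquality hiding (J)
open import Relation.Binary.Definitions using (tri<; tri≈; tri>)
open import Data.Nat.Tactic.RingSolver using (solve-∀)

-- period m = |h^m(a)| = 2^(m+1) - 1, written as a successor so that
-- instance search finds NonZero (period m).
pred-period : ℕ → ℕ
pred-period zero    = 0
pred-period (suc m) = suc (pred-period m + suc (pred-period m))

period : ℕ → ℕ
period m = suc (pred-period m)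

tailStart : ℕ → ℕ
tailStart zero    = 1
tailStart (suc m) = tailStart m + period m

tailStart-+ : ∀ m → tailStart m + m ≡ period m
tailStart-+ zero    = refl
tailStart-+ (suc m) = begin
  tailStart m + period m + suc m   ≡⟨ shuffle (tailStart m) (period m) m ⟩
  suc (tailStart m + m + period m) ≡⟨ cong (λ x → suc (x + period m)) (tailStart-+ m) ⟩
  period (suc m)                   ∎
  where
  open ≡-Reasoning
  shuffle : ∀ s p m → s + p + suc m ≡ suc (s + m + p)
  shuffle = solve-∀

m<period : ∀ m → m < period m
m<period zero    = s≤s z≤n
m<period (suc m) = s≤s (≤-trans (m<period m) (m≤m+n (period m) (period m)))

period-mono : ∀ k m → period m ≤ period (k + m)
period-mono zero    m = ≤-refl
period-mono (suc k) m = ≤-trans (period-mono k m) (≤-trans (m≤m+n _ _) (n≤1+n _))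

U : ℕ → List AB
U zero    = a ∷ []
U (suc m) = U m ++ U m ++ b ∷ []

hPow-a : ∀ m → hPow m (a ∷ []) ≡ U m
hPow-a zero    = refl
hPow-a (suc m) = begin
  h (hPow m (a ∷ []))              ≡⟨ cong h (hPow-a m) ⟩
  h (U m)                          ≡⟨ h-suc m ⟩
  U (suc m)                        ∎
  where
  open ≡-Reasoning
  h-suc : ∀ m → h (U m) ≡ U (suc m)
  h-suc zero    = refl
  h-suc (suc m) = begin
    h (U m ++ U m ++ b ∷ [])         ≡⟨ concatMap-++ hLetter (U m) _ ⟩
    h (U m) ++ h (U m ++ b ∷ [])     ≡⟨ cong (h (U m) ++_) (concatMap-++ hLetter (U m) _) ⟩
    h (U m) ++ h (U m) ++ b ∷ []     ≡⟨ cong (λ w → w ++ w ++ b ∷ []) (h-suc m) ⟩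
    U (suc (suc m))                  ∎

length-U : ∀ m → length (U m) ≡ period m
length-U zero    = refl
length-U (suc m) = begin
  length (U m ++ U m ++ b ∷ [])          ≡⟨ length-++ (U m) ⟩
  length (U m) + length (U m ++ b ∷ [])  ≡⟨ cong (length (U m) +_) (length-++ (U m)) ⟩
  length (U m) + (length (U m) + 1)      ≡⟨ cong (λ p → p + (p + 1)) (length-U m) ⟩
  period m + (period m + 1)              ≡⟨ cong (period m +_) (+-comm (period m) 1) ⟩
  period m + suc (period m)              ≡⟨ +-suc (period m) (period m) ⟩
  period (suc m)                         ∎
  where open ≡-Reasoning

nth-++ˡ : ∀ xs ys {e} → e < length xs → nth (xs ++ ys) e ≡ nth xs e
nth-++ˡ (x ∷ xs) ys {zero}  _   = refl
nth-++ˡ (x ∷ xs) ys {suc e} e<n = nth-++ˡ xs ys (≤-pred e<n)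

nth-++ʳ : ∀ xs ys e → nth (xs ++ ys) (length xs + e) ≡ nth ys e
nth-++ʳ []       ys e = refl
nth-++ʳ (x ∷ xs) ys e = nth-++ʳ xs ys e

u : ℕ → ℕ → AB
u m = nth (U m)

<length-U : ∀ m {e} → e < period m → e < length (U m)
<length-U m {e} e<p = subst (e <_) (sym (length-U m)) e<p

u-suc-low : ∀ m {e} → e < period m → u (suc m) e ≡ u m e
u-suc-low m e<p = nth-++ˡ (U m) _ (<length-U m e<p)

u-suc-right : ∀ m e → u (suc m) (period m + e) ≡ nth (U m ++ b ∷ []) e
u-suc-right m e = begin
  nth (U (suc m)) (period m + e)       ≡⟨ cong (λ p → nth (U (suc m)) (p + e)) (sym (length-U m)) ⟩
  nth (U (suc m)) (length (U m) + e)   ≡⟨ nth-++ʳ (U m) _ e ⟩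
  nth (U m ++ b ∷ []) e                ∎
  where open ≡-Reasoning

u-suc-high : ∀ m {e} → e < period m → u (suc m) (period m + e) ≡ u m e
u-suc-high m e<p = trans (u-suc-right m _) (nth-++ˡ (U m) _ (<length-U m e<p))

u-suc-last : ∀ m → u (suc m) (period m + period m) ≡ b
u-suc-last m = begin
  u (suc m) (period m + period m)       ≡⟨ u-suc-right m (period m) ⟩
  nth (U m ++ b ∷ []) (period m)        ≡⟨ cong (nth (U m ++ b ∷ [])) (sym (trans (+-identityʳ _) (length-U m))) ⟩
  nth (U m ++ b ∷ []) (length (U m) + 0) ≡⟨ nth-++ʳ (U m) _ 0 ⟩
  b                                     ∎
  where open ≡-Reasoning

0<period : ∀ m → 0 < period m
0<period m = ≤-trans (s≤s z≤n) (m<period m)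

tailStart+<period : ∀ m {k} → k < m → tailStart m + k < period m
tailStart+<period m {k} k<m = subst (tailStart m + k <_) (tailStart-+ m) (+-monoʳ-< (tailStart m) k<m)

u-first : ∀ m → u m 0 ≡ a
u-first zero    = refl
u-first (suc m) = trans (u-suc-low m (0<period m)) (u-first m)

u-tail : ∀ m {k} → k < m → u m (tailStart m + k) ≡ b
u-tail (suc m) {k} k<1+m with m<1+n⇒m<n∨m≡n k<1+m
... | inj₁ k<m = begin
  u (suc m) (tailStart m + period m + k)   ≡⟨ cong (u (suc m)) (shuffle (tailStart m) (period m) k) ⟩
  u (suc m) (period m + (tailStart m + k)) ≡⟨ u-suc-high m (tailStart+<period m k<m) ⟩
  u m (tailStart m + k)                    ≡⟨ u-tail m k<m ⟩
  b                                        ∎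
  where
  open ≡-Reasoning
  shuffle : ∀ s p k → s + p + k ≡ p + (s + k)
  shuffle = solve-∀
... | inj₂ refl = begin
  u (suc m) (tailStart m + period m + m)   ≡⟨ cong (u (suc m)) (shuffle (tailStart m) (period m) m) ⟩
  u (suc m) (tailStart m + m + period m)   ≡⟨ cong (λ x → u (suc m) (x + period m)) (tailStart-+ m) ⟩
  u (suc m) (period m + period m)          ≡⟨ u-suc-last m ⟩
  b                                        ∎
  where
  open ≡-Reasoning
  shuffle : ∀ s p k → s + p + k ≡ s + k + p
  shuffle = solve-∀

u-prefix : ∀ k m {e} → e < period m → u (k + m) e ≡ u m e
u-prefix zero    m e<p = refl
u-prefix (suc k) m e<p = trans (u-suc-low (k + m) (<-≤-trans e<p (period-mono k m))) (u-prefix k m e<p)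

z-u : ∀ m {i} → i < period m → z i ≡ u m i
z-u m {i} i<p = begin
  nth (hPow (suc i) (a ∷ [])) i ≡⟨ cong (λ w → nth w i) (hPow-a (suc i)) ⟩
  u (suc i) i                   ≡⟨ sym (u-prefix m (suc i) i<period) ⟩
  u (m + suc i) i               ≡⟨ cong (λ k → u k i) (+-comm m (suc i)) ⟩
  u (suc i + m) i               ≡⟨ u-prefix (suc i) m i<p ⟩
  u m i                         ∎
  where
  open ≡-Reasoning
  i<period : i < period (suc i)
  i<period = <-≤-trans (m<period i) (period-mono 1 i)

[m+n%d]%d≡[m+n]%d : ∀ m n d .{{_ : NonZero d}} → (m + n % d) % d ≡ (m + n) % d
[m+n%d]%d≡[m+n]%d m n d = begin
  (m + n % d) % d          ≡⟨ %-distribˡ-+ m (n % d) d ⟩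
  (m % d + n % d % d) % d  ≡⟨ cong (λ t → (m % d + t) % d) (m%n%n≡m%n n d) ⟩
  (m % d + n % d) % d      ≡⟨ sym (%-distribˡ-+ m n d) ⟩
  (m + n) % d              ∎
  where open ≡-Reasoning

Uω : ℕ → ℕ → AB
Uω m x = u m (x % period m)

Uω-u : ∀ m {x} → x < period m → Uω m x ≡ u m x
Uω-u m x<p = cong (u m) (m<n⇒m%n≡m x<p)

Uω-periodic : ∀ m x → Uω m (x + period m) ≡ Uω m x
Uω-periodic m x = cong (u m) ([m+n]%n≡m%n x (period m))

Uω-shift : ∀ m x y j → x % period m ≡ y % period m → Uω m (x + j) ≡ Uω m (y + j)
Uω-shift m x y j x≡y = cong (u m) (begin
  (x + j) % p              ≡⟨ %-distribˡ-+ x j p ⟩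
  (x % p + j % p) % p      ≡⟨ cong (λ t → (t + j % p) % p) x≡y ⟩
  (y % p + j % p) % p      ≡⟨ sym (%-distribˡ-+ y j p) ⟩
  (y + j) % p              ∎)
  where
  open ≡-Reasoning
  p = period m

Uω-u-suc : ∀ m {e} → e < period m + period m → Uω m e ≡ u (suc m) e
Uω-u-suc m {e} e<2p with e <? period m
... | yes e<p = trans (Uω-u m e<p) (sym (u-suc-low m e<p))
... | no e≮p = begin
  Uω m e                        ≡⟨ cong (Uω m) (sym e′+p) ⟩
  Uω m (e′ + period m)          ≡⟨ Uω-periodic m e′ ⟩
  Uω m e′                       ≡⟨ Uω-u m e′<p ⟩
  u m e′                        ≡⟨ sym (u-suc-high m e′<p) ⟩
  u (suc m) (period m + e′)     ≡⟨ cong (u (suc m)) p+e′ ⟩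
  u (suc m) e                   ∎
  where
  open ≡-Reasoning
  e′ = e ∸ period m
  p+e′ : period m + e′ ≡ e
  p+e′ = m+[n∸m]≡n (≮⇒≥ e≮p)
  e′+p : e′ + period m ≡ e
  e′+p = trans (+-comm e′ (period m)) p+e′
  e′<p : e′ < period m
  e′<p = +-cancelˡ-< (period m) e′ (period m) (subst (_< period m + period m) (sym p+e′) e<2p)

record SameWindow (f : ℕ → AB) (x : ℕ) (g : ℕ → AB) (y : ℕ) (ℓ : ℕ) : Set where
  constructor window
  field agree : ∀ j → j < ℓ → f (x + j) ≡ g (y + j)
open SameWindow public

SameWindow-sym : ∀ {f x g y ℓ} → SameWindow f x g y ℓ → SameWindow g y f x ℓ
SameWindow-sym w = window λ j j<ℓ → sym (agree w j j<ℓ)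

SameWindow-trans : ∀ {f x g y k v ℓ} → SameWindow f x g y ℓ → SameWindow g y k v ℓ → SameWindow f x k v ℓ
SameWindow-trans w w′ = window λ j j<ℓ → trans (agree w j j<ℓ) (agree w′ j j<ℓ)

SameWindow-b : ∀ {f x g y ℓ} → (∀ {j} → j < ℓ → f (x + j) ≡ b) → (∀ {j} → j < ℓ → g (y + j) ≡ b) →
               SameWindow f x g y ℓ
SameWindow-b fb gb = window λ _ j<ℓ → trans (fb j<ℓ) (sym (gb j<ℓ))

SameWindow-++ : ∀ {f x g y s t} → SameWindow f x g y s → SameWindow f (x + s) g (y + s) t →
                SameWindow f x g y (s + t)
SameWindow-++ {f} {x} {g} {y} {s} {t} w w′ = window agree-++
  where
  agree-++ : ∀ j → j < s + t → f (x + j) ≡ g (y + j)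
  agree-++ j j<s+t with j <? s
  ... | yes j<s = agree w j j<s
  ... | no j≮s = begin
    f (x + j)          ≡⟨ cong f (at x) ⟩
    f (x + s + e)      ≡⟨ agree w′ e (+-cancelˡ-< s e t (subst (_< s + t) (sym s+e) j<s+t)) ⟩
    g (y + s + e)      ≡⟨ cong g (sym (at y)) ⟩
    g (y + j)          ∎
    where
    open ≡-Reasoning
    e = j ∸ s
    s+e : s + e ≡ j
    s+e = m+[n∸m]≡n (≮⇒≥ j≮s)
    at : ∀ z → z + j ≡ z + s + e
    at z = trans (cong (z +_) (sym s+e)) (sym (+-assoc z s e))

SameWindow-≤ : ∀ {f x g y ℓ ℓ′} → ℓ′ ≤ ℓ → SameWindow f x g y ℓ → SameWindow f x g y ℓ′
SameWindow-≤ ℓ′≤ℓ w = window λ j j<ℓ′ → agree w j (<-≤-trans j<ℓ′ ℓ′≤ℓ)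

anchor : ℕ → ℕ
anchor m = suc (tailStart (suc m))

anchor-+ : ∀ m → anchor m + m ≡ period (suc m)
anchor-+ m = trans (sym (+-suc (tailStart (suc m)) m)) (tailStart-+ (suc m))

offset : ℕ → ℕ → ℕ
offset m t = (t + m) % period (suc m)

offset<period : ∀ m t → offset m t < period (suc m)
offset<period m t = m%n<n (t + m) (period (suc m))

SameWindow-offset : ∀ m t ℓ → SameWindow (Uω (suc m)) t (Uω (suc m)) (anchor m + offset m t) ℓ
SameWindow-offset m t ℓ = window λ j _ → Uω-shift (suc m) t (anchor m + offset m t) j (sym (begin
  (anchor m + (t + m) % p) % p ≡⟨ [m+n%d]%d≡[m+n]%d (anchor m) (t + m) p ⟩
  (anchor m + (t + m)) % p     ≡⟨ cong (_% p) (shuffle (anchor m) t m) ⟩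
  (t + (anchor m + m)) % p     ≡⟨ cong (λ x → (t + x) % p) (anchor-+ m) ⟩
  (t + p) % p                  ≡⟨ [m+n]%n≡m%n t p ⟩
  t % p                        ∎))
  where
  open ≡-Reasoning
  p = period (suc m)
  shuffle : ∀ x t m → x + (t + m) ≡ t + (x + m)
  shuffle = solve-∀

-- Read from anchor m, U(m+1)^ω starts b^m U_m U_m b, while U_m^ω read from
-- tailStart m starts b^m U_m U_m a: they agree on the first m + 2|U_m| letters.
Uω-suc-anchor : ∀ m {k} → k < m + (period m + period m) →
                Uω (suc m) (anchor m + k) ≡ Uω m (tailStart m + k)
Uω-suc-anchor m {k} k<bound with k <? m
... | yes k<m = begin
  Uω (suc m) (anchor m + k)                ≡⟨ cong (Uω (suc m)) (sym (+-suc (tailStart (suc m)) k)) ⟩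
  Uω (suc m) (tailStart (suc m) + suc k)   ≡⟨ Uω-u (suc m) (tailStart+<period (suc m) (s≤s k<m)) ⟩
  u (suc m) (tailStart (suc m) + suc k)    ≡⟨ u-tail (suc m) (s≤s k<m) ⟩
  b                                        ≡⟨ sym (u-tail m k<m) ⟩
  u m (tailStart m + k)                    ≡⟨ sym (Uω-u m (tailStart+<period m k<m)) ⟩
  Uω m (tailStart m + k)                   ∎
  where open ≡-Reasoning
... | no k≮m = begin
  Uω (suc m) (anchor m + k)                ≡⟨ cong (Uω (suc m)) (at-period (anchor m) (anchor-+ m)) ⟩
  Uω (suc m) (e + period (suc m))          ≡⟨ Uω-periodic (suc m) e ⟩
  Uω (suc m) e                             ≡⟨ Uω-u (suc m) (≤-trans e<2p (n≤1+n _)) ⟩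
  u (suc m) e                              ≡⟨ sym (Uω-u-suc m e<2p) ⟩
  Uω m e                                   ≡⟨ sym (Uω-periodic m e) ⟩
  Uω m (e + period m)                      ≡⟨ cong (Uω m) (sym (at-period (tailStart m) (tailStart-+ m))) ⟩
  Uω m (tailStart m + k)                   ∎
  where
  open ≡-Reasoning
  e = k ∸ m
  m+e : m + e ≡ k
  m+e = m+[n∸m]≡n (≮⇒≥ k≮m)
  e<2p : e < period m + period m
  e<2p = +-cancelˡ-< m e _ (subst (_< m + (period m + period m)) (sym m+e) k<bound)
  at-period : ∀ s {p} → s + m ≡ p → s + k ≡ e + p
  at-period s {p} s+m≡p = begin
    s + k       ≡⟨ cong (s +_) (sym m+e) ⟩
    s + (m + e) ≡⟨ sym (+-assoc s m e) ⟩
    s + m + e   ≡⟨ cong (_+ e) s+m≡p ⟩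
    p + e       ≡⟨ +-comm p e ⟩
    e + p       ∎

SameWindow-anchor : ∀ m d ℓ → d + ℓ ≤ m + (period m + period m) →
                    SameWindow (Uω (suc m)) (anchor m + d) (Uω m) (tailStart m + d) ℓ
SameWindow-anchor m d ℓ fits = window λ j j<ℓ → begin
  Uω (suc m) (anchor m + d + j)     ≡⟨ cong (Uω (suc m)) (+-assoc (anchor m) d j) ⟩
  Uω (suc m) (anchor m + (d + j))   ≡⟨ Uω-suc-anchor m (<-≤-trans (+-monoʳ-< d j<ℓ) fits) ⟩
  Uω m (tailStart m + (d + j))      ≡⟨ cong (Uω m) (sym (+-assoc (tailStart m) d j)) ⟩
  Uω m (tailStart m + d + j)        ∎
  where open ≡-Reasoning

BRun : ℕ → (ℕ → AB) → ℕ → Set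
BRun m f x = ∀ {k} → k ≤ m → f (x + k) ≡ b

AWithin : ℕ → (ℕ → AB) → ℕ → Set
AWithin m f x = ∃ λ k → k ≤ m × f (x + k) ≡ a

Uω-suc-run : ∀ m → BRun m (Uω (suc m)) (anchor m + (period m + period m))
Uω-suc-run m {k} k≤m = begin
  Uω (suc m) (anchor m + (p + p) + k)              ≡⟨ cong (Uω (suc m)) (shuffle (tailStart m) p k) ⟩
  Uω (suc m) (tailStart (suc m) + k + period (suc m)) ≡⟨ Uω-periodic (suc m) (tailStart (suc m) + k) ⟩
  Uω (suc m) (tailStart (suc m) + k)              ≡⟨ Uω-u (suc m) (tailStart+<period (suc m) (s≤s k≤m)) ⟩
  u (suc m) (tailStart (suc m) + k)               ≡⟨ u-tail (suc m) (s≤s k≤m) ⟩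
  b                                               ∎
  where
  open ≡-Reasoning
  p = period m
  shuffle : ∀ s p k → suc (s + p) + (p + p) + k ≡ s + p + k + suc (p + p)
  shuffle = solve-∀

a≢b : a ≢ b
a≢b ()

run-mismatch : ∀ m {f x g y ℓ} o → o + m < ℓ → AWithin m f (x + o) → BRun m g (y + o) →
               ¬ SameWindow f x g y ℓ
run-mismatch m {f} {x} {g} {y} o o+m<ℓ (k , k≤m , fa) gb w = a≢b (begin
  a                   ≡⟨ sym fa ⟩
  f (x + o + k)       ≡⟨ cong f (+-assoc x o k) ⟩
  f (x + (o + k))     ≡⟨ agree w (o + k) (≤-<-trans (+-monoʳ-≤ o k≤m) o+m<ℓ) ⟩
  g (y + (o + k))     ≡⟨ cong g (sym (+-assoc y o k)) ⟩
  g (y + o + k)       ≡⟨ gb k≤m ⟩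
  b                   ∎)
  where open ≡-Reasoning

AWithin-periodic : ∀ m n x → AWithin m (Uω n) x → AWithin m (Uω n) (x + period n)
AWithin-periodic m n x (k , k≤m , fa) = k , k≤m , (begin
  Uω n (x + period n + k)  ≡⟨ cong (Uω n) (shuffle x (period n) k) ⟩
  Uω n (x + k + period n)  ≡⟨ Uω-periodic n (x + k) ⟩
  Uω n (x + k)             ≡⟨ fa ⟩
  a                        ∎)
  where
  open ≡-Reasoning
  shuffle : ∀ x p k → x + p + k ≡ x + k + p
  shuffle = solve-∀

mutual
  Uω-AWithin : ∀ m x → AWithin m (Uω m) x
  Uω-AWithin zero    x = 0 , z≤n , cong (u 0) (n%1≡0 (x + 0))
  Uω-AWithin (suc m) x with offset m x <? period m + period m
  ... | yes d<2p = let k , k≤m , fa = AWithin-anchor m d<2p in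
    k , m≤n⇒m≤1+n k≤m , trans (agree (SameWindow-offset m x (suc k)) k ≤-refl) fa
  ... | no d≮2p = suc m , ≤-refl , (begin
    Uω (suc m) (x + suc m)                          ≡⟨ agree (SameWindow-offset m x (suc (suc m))) (suc m) ≤-refl ⟩
    Uω (suc m) (anchor m + d + suc m)               ≡⟨ cong (λ e → Uω (suc m) (anchor m + e + suc m)) d≡2p ⟩
    Uω (suc m) (anchor m + (p + p) + suc m)         ≡⟨ cong (Uω (suc m)) (shuffle (anchor m) p m) ⟩
    Uω (suc m) (anchor m + m + period (suc m))      ≡⟨ cong (λ e → Uω (suc m) (e + period (suc m))) (anchor-+ m) ⟩
    Uω (suc m) (period (suc m) + period (suc m))    ≡⟨ Uω-periodic (suc m) (period (suc m)) ⟩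
    Uω (suc m) (period (suc m))                     ≡⟨ Uω-periodic (suc m) 0 ⟩
    Uω (suc m) 0                                    ≡⟨ u-first (suc m) ⟩
    a                                               ∎)
    where
    open ≡-Reasoning
    p = period m
    d = offset m x
    d≡2p : d ≡ p + p
    d≡2p = ≤-antisym (≤-pred (offset<period m x)) (≮⇒≥ d≮2p)
    shuffle : ∀ t p m → t + (p + p) + suc m ≡ t + m + suc (p + p)
    shuffle = solve-∀

  AWithin-anchor : ∀ m {δ} → δ < period m + period m → AWithin m (Uω (suc m)) (anchor m + δ)
  AWithin-anchor m {δ} δ<2p with Uω-AWithin m (tailStart m + δ)
  ... | k , k≤m , fa = k , k≤m , trans (agree (SameWindow-anchor m δ (suc k) fits) k ≤-refl) fa
    where
    fits : δ + suc k ≤ m + (period m + period m)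
    fits = subst (_≤ m + (period m + period m)) (sym (+-suc δ k))
             (subst (suc δ + k ≤_) (+-comm _ m) (+-mono-≤ δ<2p k≤m))

run-window-new : ∀ m {d o ℓ} x → d + o ≡ period m + period m → o + m < ℓ →
                 ¬ SameWindow (Uω m) x (Uω (suc m)) (anchor m + d) ℓ
run-window-new m {d} {o} x d+o o+m<ℓ =
  run-mismatch m o o+m<ℓ (Uω-AWithin m (x + o)) (subst (BRun m (Uω (suc m))) at-run (Uω-suc-run m))
  where
  at-run : anchor m + (period m + period m) ≡ anchor m + d + o
  at-run = trans (cong (anchor m +_) (sym d+o)) (sym (+-assoc (anchor m) d o))

run-windows-distinct : ∀ m {d d′ o ℓ} → d + o ≡ period m + period m → d < d′ → d′ ≤ period m + period m →
                       o + m < ℓ → ¬ SameWindow (Uω (suc m)) (anchor m + d) (Uω (suc m)) (anchor m + d′) ℓ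
run-windows-distinct m {d} {d′} {o} d+o d<d′ d′≤2p o+m<ℓ w =
  run-mismatch m o o+m<ℓ
    (subst (AWithin m (Uω (suc m))) at-a (AWithin-periodic m (suc m) (anchor m + δ) (AWithin-anchor m δ<2p)))
    (subst (BRun m (Uω (suc m))) at-run (Uω-suc-run m))
    (SameWindow-sym w)
  where
  δ = d′ ∸ suc d
  d+1+δ : d + suc δ ≡ d′
  d+1+δ = trans (+-suc d δ) (m+[n∸m]≡n d<d′)
  δ<2p : δ < period m + period m
  δ<2p = ≤-trans (m≤n+m (suc δ) d) (subst (_≤ period m + period m) (sym d+1+δ) d′≤2p)
  shuffle : ∀ t d δ o → t + (d + suc δ) + o ≡ t + δ + suc (d + o)
  shuffle = solve-∀
  at-a : anchor m + δ + period (suc m) ≡ anchor m + d′ + o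
  at-a = begin
    anchor m + δ + suc (period m + period m) ≡⟨ cong (λ e → anchor m + δ + suc e) (sym d+o) ⟩
    anchor m + δ + suc (d + o)               ≡⟨ sym (shuffle (anchor m) d δ o) ⟩
    anchor m + (d + suc δ) + o               ≡⟨ cong (λ e → anchor m + e + o) d+1+δ ⟩
    anchor m + d′ + o                        ∎
    where open ≡-Reasoning
  at-run : anchor m + (period m + period m) ≡ anchor m + d + o
  at-run = trans (cong (anchor m +_) (sym d+o)) (sym (+-assoc (anchor m) d o))

sepLength : ℕ → ℕ
sepLength zero    = 0
sepLength (suc m) = suc (period m + m)

sepLength-suc : ∀ m → sepLength m ≤ sepLength (suc m)
sepLength-suc zero    = z≤n
sepLength-suc (suc m) = s≤s (+-mono-≤ (≤-trans (m≤m+n (period m) (period m)) (n≤1+n _)) (n≤1+n m))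

short-offset-fits : ∀ m {d} → d < period m → d + sepLength (suc m) ≤ m + (period m + period m)
short-offset-fits m {d} d<p = begin
  d + suc (p + m)   ≡⟨ +-suc d (p + m) ⟩
  suc d + (p + m)   ≤⟨ +-monoˡ-≤ (p + m) d<p ⟩
  p + (p + m)       ≡⟨ shuffle p m ⟩
  m + (p + p)       ∎
  where
  open ≤-Reasoning
  p = period m
  shuffle : ∀ p m → p + (p + m) ≡ m + (p + p)
  shuffle = solve-∀

distance-to-run : ∀ m {d} → period m ≤ d → (period m + period m) ∸ d + m < sepLength (suc m)
distance-to-run m {d} p≤d = s≤s (+-monoˡ-≤ m (begin
  (p + p) ∸ d   ≤⟨ ∸-monoʳ-≤ (p + p) p≤d ⟩
  (p + p) ∸ p   ≡⟨ m+n∸n≡m p p ⟩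
  p             ∎))
  where
  open ≤-Reasoning
  p = period m

%-separates : ∀ {x y} n .{{_ : NonZero n}} → x < y → y < x + n → x % n ≢ y % n
%-separates {x} {y} n x<y y<x+n x%≡y% = <⇒≱ x/<y/ (≤-pred y/<1+x/)
  where
  r = x % n
  x≡ : x ≡ r + x / n * n
  x≡ = m≡m%n+[m/n]*n x n
  y≡ : y ≡ r + y / n * n
  y≡ = trans (m≡m%n+[m/n]*n y n) (cong (_+ y / n * n) (sym x%≡y%))
  x/<y/ : x / n < y / n
  x/<y/ = *-cancelʳ-< n _ _ (+-cancelˡ-< r _ _ (subst₂ _<_ x≡ y≡ x<y))
  shuffle : ∀ r q n → r + q * n + n ≡ r + (n + q * n)
  shuffle = solve-∀
  y/<1+x/ : y / n < suc (x / n)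
  y/<1+x/ = *-cancelʳ-< n _ _ (+-cancelˡ-< r _ _
              (subst₂ _<_ y≡ (trans (cong (_+ n) x≡) (shuffle r (x / n) n)) y<x+n))

-- Two anchored windows of U(m+1)^ω either both lie in the part aligned with U_m^ω,
-- or one of them contains the run b^(m+1) where the other has an a.
mutual
  Uω-windows-separated : ∀ m {x y ℓ} → sepLength m ≤ ℓ → x < y → y < x + period m →
                         ¬ SameWindow (Uω m) x (Uω m) y ℓ
  Uω-windows-separated zero {x} {y} _ x<y y<x+1 _ = <⇒≱ x<y (≤-pred (subst (y <_) (+-comm x 1) y<x+1))
  Uω-windows-separated (suc m) {x} {y} {ℓ} sep≤ℓ x<y y<x+p w with <-cmp (offset m x) (offset m y)
  ... | tri< dx<dy _ _ = anchored-windows-separated m dx<dy (offset<period m y)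
          (SameWindow-trans (SameWindow-sym (SameWindow-offset m x _))
            (SameWindow-trans (SameWindow-≤ sep≤ℓ w) (SameWindow-offset m y _)))
  ... | tri≈ _ dx≡dy _ = %-separates (period (suc m)) (+-monoˡ-< m x<y)
          (subst (y + m <_) (shuffle x m (period (suc m))) (+-monoˡ-< m y<x+p)) dx≡dy
    where
    shuffle : ∀ x m p → x + p + m ≡ x + m + p
    shuffle = solve-∀
  ... | tri> _ _ dy<dx = anchored-windows-separated m dy<dx (offset<period m x)
          (SameWindow-trans (SameWindow-sym (SameWindow-offset m y _))
            (SameWindow-trans (SameWindow-sym (SameWindow-≤ sep≤ℓ w)) (SameWindow-offset m x _)))

  anchored-windows-separated : ∀ m {d d′} → d < d′ → d′ < period (suc m) →
    ¬ SameWindow (Uω (suc m)) (anchor m + d) (Uω (suc m)) (anchor m + d′) (sepLength (suc m))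
  anchored-windows-separated m {d} {d′} d<d′ d′<p′ w with d′ <? period m | d <? period m
  ... | yes d′<p | _ = Uω-windows-separated m (sepLength-suc m) (+-monoʳ-< (tailStart m) d<d′) far
          (SameWindow-trans (SameWindow-sym (old d (<-trans d<d′ d′<p)))
            (SameWindow-trans w (old d′ d′<p)))
    where
    old : ∀ e → e < period m → SameWindow (Uω (suc m)) (anchor m + e) (Uω m) (tailStart m + e) (sepLength (suc m))
    old e e<p = SameWindow-anchor m e _ (short-offset-fits m e<p)
    far : tailStart m + d′ < tailStart m + d + period m
    far = subst (tailStart m + d′ <_) (sym (+-assoc (tailStart m) d (period m)))
            (+-monoʳ-< (tailStart m) (≤-trans d′<p (m≤n+m (period m) d)))
  ... | no d′≮p | yes d<p = run-window-new m (tailStart m + d) (m+[n∸m]≡n (≤-pred d′<p′)) (distance-to-run m (≮⇒≥ d′≮p))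
          (SameWindow-trans (SameWindow-sym (SameWindow-anchor m d _ (short-offset-fits m d<p))) w)
  ... | no _ | no d≮p = run-windows-distinct m (m+[n∸m]≡n (≤-trans (<⇒≤ d<d′) (≤-pred d′<p′))) d<d′
          (≤-pred d′<p′) (distance-to-run m (≮⇒≥ d≮p)) w

summand : ℕ → ℕ → ℕ
summand ℓ i = (2 ^ i) ⊓ (ℓ ∸ i + 1)

-- formula n is complexitySum n n.
complexitySum : ℕ → ℕ → ℕ
complexitySum m ℓ = sum (map (summand ℓ) (upTo (suc m)))

complexitySum-zero : ∀ ℓ → complexitySum 0 ℓ ≡ 1
complexitySum-zero ℓ = trans (+-identityʳ _) (cong (1 ⊓_) (+-comm ℓ 1))

complexitySum-suc : ∀ m ℓ → complexitySum (suc m) ℓ ≡ complexitySum m ℓ + summand ℓ (suc m)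
complexitySum-suc m ℓ = begin
  sum (map (summand ℓ) (upTo (suc (suc m))))                    ≡⟨ cong (sum ∘ map (summand ℓ)) (sym (upTo-∷ʳ (suc m))) ⟩
  sum (map (summand ℓ) (upTo (suc m) ∷ʳ suc m))                 ≡⟨ cong sum (map-++ (summand ℓ) (upTo (suc m)) _) ⟩
  sum (map (summand ℓ) (upTo (suc m)) ++ summand ℓ (suc m) ∷ [])   ≡⟨ sum-++ (map (summand ℓ) (upTo (suc m))) _ ⟩
  complexitySum m ℓ + (summand ℓ (suc m) + 0)                  ≡⟨ cong (complexitySum m ℓ +_) (+-identityʳ _) ⟩
  complexitySum m ℓ + summand ℓ (suc m)                        ∎
  where open ≡-Reasoning

suc-period : ∀ m → suc (period m) ≡ 2 ^ suc m
suc-period zero    = refl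
suc-period (suc m) = trans (shuffle (period m)) (cong (λ x → x + (x + 0)) (suc-period m))
  where
  shuffle : ∀ p → suc (suc (p + p)) ≡ suc p + (suc p + 0)
  shuffle = solve-∀

∸-suc+1 : ∀ m {ℓ} → m < ℓ → ℓ ∸ suc m + 1 ≡ ℓ ∸ m
∸-suc+1 m m<ℓ = trans (+-comm _ 1) (sym (+-∸-assoc 1 m<ℓ))

summand-short : ∀ m {ℓ} → m < ℓ → ℓ ≤ sepLength (suc m) → summand ℓ (suc m) ≡ ℓ ∸ m
summand-short m {ℓ} m<ℓ ℓ≤sep = trans (cong (2 ^ suc m ⊓_) (∸-suc+1 m m<ℓ)) (m≥n⇒m⊓n≡n (begin
  ℓ ∸ m                      ≤⟨ ∸-monoˡ-≤ m ℓ≤sep ⟩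
  suc (period m) + m ∸ m     ≡⟨ m+n∸n≡m (suc (period m)) m ⟩
  suc (period m)             ≡⟨ suc-period m ⟩
  2 ^ suc m                  ∎))
  where open ≤-Reasoning

complexitySum-saturated : ∀ m {ℓ} → 2 ^ m + m ≤ ℓ + 1 → complexitySum m ℓ ≡ period m
complexitySum-saturated zero    {ℓ} _ = complexitySum-zero ℓ
complexitySum-saturated (suc m) {ℓ} bound = begin
  complexitySum (suc m) ℓ               ≡⟨ complexitySum-suc m ℓ ⟩
  complexitySum m ℓ + summand ℓ (suc m)    ≡⟨ cong₂ _+_ (complexitySum-saturated m bound′) full-summand ⟩
  period m + 2 ^ suc m                  ≡⟨ cong (period m +_) (sym (suc-period m)) ⟩
  period m + suc (period m)             ≡⟨ +-suc (period m) (period m) ⟩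
  period (suc m)                        ∎
  where
  open ≡-Reasoning
  X = 2 ^ suc m
  bound′ : 2 ^ m + m ≤ ℓ + 1
  bound′ = ≤-trans (+-mono-≤ (^-monoʳ-≤ 2 (n≤1+n m)) (n≤1+n m)) bound
  X+m≤ℓ : X + m ≤ ℓ
  X+m≤ℓ = ≤-pred (subst₂ _≤_ (+-suc X m) (+-comm ℓ 1) bound)
  m<ℓ : m < ℓ
  m<ℓ = ≤-trans (+-monoˡ-≤ m (subst (1 ≤_) (suc-period m) (s≤s z≤n))) X+m≤ℓ
  full-summand : summand ℓ (suc m) ≡ X
  full-summand = m≤n⇒m⊓n≡m (subst₂ _≤_ (m+n∸n≡m X m) (sym (∸-suc+1 m m<ℓ)) (∸-monoˡ-≤ m X+m≤ℓ))

Distinct : (ℕ → AB) → ℕ → List ℕ → Set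
Distinct f ℓ = AllPairs (λ x y → ¬ SameWindow f x f y ℓ)

Covering : (ℕ → AB) → ℕ → List ℕ → Set
Covering f ℓ ps = ∀ t → Any (λ p → SameWindow f t f p ℓ) ps

record WindowReps (m ℓ : ℕ) : Set where
  field
    positions : List ℕ
    count     : length positions ≡ complexitySum m ℓ
    distinct  : Distinct (Uω m) ℓ positions
    covering  : Covering (Uω m) ℓ positions

reps-zero : ∀ ℓ → WindowReps 0 ℓ
reps-zero ℓ = record
  { positions = 0 ∷ []
  ; count     = sym (complexitySum-zero ℓ)
  ; distinct  = All.[] AP.∷ AP.[]
  ; covering  = λ t → here (window λ j _ → Uω-shift 0 t 0 j (trans (n%1≡0 t) (sym (n%1≡0 0))))
  }

reps-long : ∀ m {ℓ} → sepLength (suc m) < ℓ → WindowReps (suc m) ℓ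
reps-long m {ℓ} sep<ℓ = record
  { positions = applyUpTo (anchor m +_) (period (suc m))
  ; count     = trans (length-applyUpTo (anchor m +_) _) (sym (complexitySum-saturated (suc m) bound))
  ; distinct  = APP.applyUpTo⁺₁ _ _ λ i<j j<p w →
                  anchored-windows-separated m i<j j<p (SameWindow-≤ (<⇒≤ sep<ℓ) w)
  ; covering  = λ t → AnyP.applyUpTo⁺ (anchor m +_) (SameWindow-offset m t ℓ) (offset<period m t)
  }
  where
  bound : 2 ^ suc m + suc m ≤ ℓ + 1
  bound = subst (λ x → x + suc m ≤ ℓ + 1) (suc-period m)
            (≤-trans (subst (_≤ ℓ) (sym (+-suc (suc (period m)) m)) sep<ℓ) (m≤m+n ℓ 1))

SameWindow-tailStart : ∀ m x ℓ → SameWindow (Uω m) (tailStart m + (x + m) % period m) (Uω m) x ℓ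
SameWindow-tailStart m x ℓ = window λ j _ → Uω-shift m (tailStart m + (x + m) % period m) x j (begin
  (tailStart m + (x + m) % p) % p ≡⟨ [m+n%d]%d≡[m+n]%d (tailStart m) (x + m) p ⟩
  (tailStart m + (x + m)) % p     ≡⟨ cong (_% p) (shuffle (tailStart m) x m) ⟩
  (x + (tailStart m + m)) % p     ≡⟨ cong (λ e → (x + e) % p) (tailStart-+ m) ⟩
  (x + p) % p                     ≡⟨ [m+n]%n≡m%n x p ⟩
  x % p                           ∎)
  where
  open ≡-Reasoning
  p = period m
  shuffle : ∀ s x m → s + (x + m) ≡ x + (s + m)
  shuffle = solve-∀

-- The windows of U(m+1)^ω of a length ℓ with m < ℓ ≤ |U_m| + m + 1 are those of
-- U_m^ω together with the c = ℓ - m windows containing the run b^(m+1).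
module ShortWindows (m ℓ : ℕ) (m<ℓ : m < ℓ) (ℓ≤sep : ℓ ≤ sepLength (suc m)) (old : WindowReps m ℓ) where
  open WindowReps old

  p : ℕ
  p = period m

  c : ℕ
  c = ℓ ∸ m

  lo : ℕ
  lo = suc (p + p) ∸ c

  m+c : m + c ≡ ℓ
  m+c = m+[n∸m]≡n (<⇒≤ m<ℓ)

  lo+c : lo + c ≡ suc (p + p)
  lo+c = m∸n+n≡m (begin
    c                        ≤⟨ ∸-monoˡ-≤ m ℓ≤sep ⟩
    suc (p + m) ∸ m          ≡⟨ m+n∸n≡m (suc p) m ⟩
    suc p                    ≤⟨ s≤s (m≤m+n p p) ⟩
    suc (p + p)              ∎)
    where open ≤-Reasoning

  lift : ℕ → ℕ
  lift x = anchor m + (x + m) % p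

  lift-window : ∀ x → SameWindow (Uω (suc m)) (lift x) (Uω m) x ℓ
  lift-window x = SameWindow-trans
    (SameWindow-anchor m _ ℓ (≤-trans (+-monoʳ-≤ _ ℓ≤sep) (short-offset-fits m (m%n<n (x + m) p))))
    (SameWindow-tailStart m x ℓ)

  new : ℕ → ℕ
  new i = anchor m + (lo + i)

  run-offset : ∀ {i} → i < c → lo + i + (c ∸ suc i) ≡ p + p
  run-offset {i} i<c = suc-injective (begin
    suc (lo + i + (c ∸ suc i)) ≡⟨ shuffle lo i (c ∸ suc i) ⟩
    lo + (suc i + (c ∸ suc i)) ≡⟨ cong (lo +_) (m+[n∸m]≡n i<c) ⟩
    lo + c                     ≡⟨ lo+c ⟩
    suc (p + p)                ∎)
    where
    open ≡-Reasoning
    shuffle : ∀ l i o → suc (l + i + o) ≡ l + (suc i + o)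
    shuffle = solve-∀

  run-near : ∀ {i} → i < c → c ∸ suc i + m < ℓ
  run-near {i} i<c = subst (c ∸ suc i + m <_) (trans (+-comm c m) m+c) (+-monoˡ-< m (∸-monoʳ-< (s≤s z≤n) i<c))

  old-distinct : Distinct (Uω (suc m)) ℓ (map lift positions)
  old-distinct = APP.map⁺ (AP.map (λ {x} {y} ≉ w →
    ≉ (SameWindow-trans (SameWindow-sym (lift-window x)) (SameWindow-trans w (lift-window y)))) distinct)

  new-distinct : Distinct (Uω (suc m)) ℓ (applyUpTo new c)
  new-distinct = APP.applyUpTo⁺₁ new c λ {i} {j} i<j j<c →
    run-windows-distinct m (run-offset (<-trans i<j j<c)) (+-monoʳ-< lo i<j)
      (≤-pred (subst (lo + j <_) lo+c (+-monoʳ-< lo j<c))) (run-near (<-trans i<j j<c))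

  old-new-distinct : All (λ x → All (λ y → ¬ SameWindow (Uω (suc m)) x (Uω (suc m)) y ℓ) (applyUpTo new c))
                         (map lift positions)
  old-new-distinct = All.tabulate λ x∈ → All.tabulate λ y∈ → separated x∈ y∈
    where
    separated : ∀ {x y} → x ∈ map lift positions → y ∈ applyUpTo new c → ¬ SameWindow (Uω (suc m)) x (Uω (suc m)) y ℓ
    separated x∈ y∈ w with ∈-map⁻ lift x∈ | ∈-applyUpTo⁻ new y∈
    ... | q , _ , refl | i , i<c , refl =
      run-window-new m q (run-offset i<c) (run-near i<c) (SameWindow-trans (SameWindow-sym (lift-window q)) w)

  covering′ : Covering (Uω (suc m)) ℓ (map lift positions ++ applyUpTo new c)
  covering′ t with offset m t <? lo
  ... | yes d<lo = AnyP.++⁺ˡ (AnyP.map⁺ (Any.map (λ {q} w →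
          SameWindow-trans (SameWindow-trans (SameWindow-offset m t ℓ) (SameWindow-anchor m d ℓ fits))
                           (SameWindow-trans w (SameWindow-sym (lift-window q))))
        (covering (tailStart m + d))))
    where
    d = offset m t
    fits : d + ℓ ≤ m + (p + p)
    fits = begin
      d + ℓ         ≡⟨ cong (d +_) (sym m+c) ⟩
      d + (m + c)   ≡⟨ shuffle d m c ⟩
      m + (d + c)   ≤⟨ +-monoʳ-≤ m (≤-pred (subst (d + c <_) lo+c (+-monoˡ-< c d<lo))) ⟩
      m + (p + p)   ∎
      where
      open ≤-Reasoning
      shuffle : ∀ d m c → d + (m + c) ≡ m + (d + c)
      shuffle = solve-∀
  ... | no d≮lo = AnyP.++⁺ʳ (map lift positions) (AnyP.applyUpTo⁺ new
          (subst (λ e → SameWindow (Uω (suc m)) t (Uω (suc m)) (anchor m + e) ℓ) (sym lo+i) (SameWindow-offset m t ℓ))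
          i<c)
    where
    i = offset m t ∸ lo
    lo+i : lo + i ≡ offset m t
    lo+i = m+[n∸m]≡n (≮⇒≥ d≮lo)
    i<c : i < c
    i<c = +-cancelˡ-< lo i c (subst₂ _<_ (sym lo+i) (sym lo+c) (offset<period m t))

  reps : WindowReps (suc m) ℓ
  reps = record
    { positions = map lift positions ++ applyUpTo new c
    ; count     = begin
        length (map lift positions ++ applyUpTo new c)          ≡⟨ length-++ (map lift positions) ⟩
        length (map lift positions) + length (applyUpTo new c)  ≡⟨ cong₂ _+_ (trans (length-map lift positions) count)
                                                                         (length-applyUpTo new c) ⟩
        complexitySum m ℓ + c                                   ≡⟨ cong (complexitySum m ℓ +_) (sym (summand-short m m<ℓ ℓ≤sep)) ⟩
        complexitySum m ℓ + summand ℓ (suc m)                      ≡⟨ sym (complexitySum-suc m ℓ) ⟩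
        complexitySum (suc m) ℓ                                 ∎
    ; distinct  = APP.++⁺ old-distinct new-distinct old-new-distinct
    ; covering  = covering′
    }
    where open ≡-Reasoning

window-reps : ∀ m ℓ → m ≤ ℓ → WindowReps m ℓ
window-reps zero    ℓ _     = reps-zero ℓ
window-reps (suc m) ℓ m<ℓ with ℓ ≤? sepLength (suc m)
... | yes ℓ≤sep = ShortWindows.reps m ℓ m<ℓ ℓ≤sep (window-reps m ℓ (<⇒≤ m<ℓ))
... | no  ℓ≰sep = reps-long m (≰⇒> ℓ≰sep)

u-b-between : ∀ m {i} → tailStart m ≤ i → i < period m → u m i ≡ b
u-b-between m {i} S≤i i<p = begin
  u m i                     ≡⟨ cong (u m) (sym S+k) ⟩
  u m (tailStart m + k)     ≡⟨ u-tail m (+-cancelˡ-< (tailStart m) k m (subst₂ _<_ (sym S+k) (sym (tailStart-+ m)) i<p)) ⟩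
  b                         ∎
  where
  open ≡-Reasoning
  k = i ∸ tailStart m
  S+k : tailStart m + k ≡ i
  S+k = m+[n∸m]≡n S≤i

SameWindow-u-suc-low : ∀ J {q ℓ} → q + ℓ ≤ period J → SameWindow (u (suc J)) q (u J) q ℓ
SameWindow-u-suc-low J {q} q+ℓ≤P = window λ j j<ℓ → u-suc-low J (<-≤-trans (+-monoʳ-< q j<ℓ) q+ℓ≤P)

SameWindow-u-suc-high : ∀ J {q ℓ} → q + ℓ ≤ period J → SameWindow (u (suc J)) (period J + q) (u J) q ℓ
SameWindow-u-suc-high J {q} q+ℓ≤P = window λ j j<ℓ →
  trans (cong (u (suc J)) (+-assoc (period J) q j)) (u-suc-high J (<-≤-trans (+-monoʳ-< q j<ℓ) q+ℓ≤P))

u-b-block : ∀ m {q ℓ} → tailStart m ≤ q → q + ℓ ≤ period m → ∀ {j} → j < ℓ → u m (q + j) ≡ b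
u-b-block m {q} S≤q q+ℓ≤p j<ℓ = u-b-between m (≤-trans S≤q (m≤m+n q _)) (<-≤-trans (+-monoʳ-< q j<ℓ) q+ℓ≤p)

Uω-b-block : ∀ m {q ℓ} → tailStart m ≤ q → q + ℓ ≤ period m → ∀ {j} → j < ℓ → Uω m (q + j) ≡ b
Uω-b-block m {q} S≤q q+ℓ≤p j<ℓ = trans (Uω-u m (<-≤-trans (+-monoʳ-< q j<ℓ) q+ℓ≤p)) (u-b-block m S≤q q+ℓ≤p j<ℓ)

window-in-tail : ∀ m {q} n → tailStart m ≤ q → q + n ≤ period m → SameWindow (u m) q (Uω n) (tailStart n) n
window-in-tail m n S≤q q+n≤p = SameWindow-b (u-b-block m S≤q q+n≤p) (Uω-b-block n ≤-refl (≤-reflexive (tailStart-+ n)))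

window-at-boundary : ∀ J {n ℓ} → ℓ ≤ n → n ≤ J → SameWindow (u (suc J)) (period J) (Uω n) (period n) ℓ
window-at-boundary J {n} ℓ≤n n≤J = window λ j j<ℓ → let j<n = <-≤-trans j<ℓ ℓ≤n in begin
  u (suc J) (period J + j)    ≡⟨ u-suc-high J (<-trans (<-≤-trans j<n n≤J) (m<period J)) ⟩
  u J j                       ≡⟨ cong (λ k → u k j) (sym (m∸n+n≡m n≤J)) ⟩
  u (J ∸ n + n) j             ≡⟨ u-prefix (J ∸ n) n (<-trans j<n (m<period n)) ⟩
  u n j                       ≡⟨ sym (Uω-u n (<-trans j<n (m<period n))) ⟩
  Uω n j                      ≡⟨ sym (Uω-periodic n j) ⟩
  Uω n (j + period n)         ≡⟨ cong (Uω n) (+-comm j (period n)) ⟩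
  Uω n (period n + j)         ∎
  where open ≡-Reasoning

-- A window across the middle of U_J U_J b reads b^s followed by a prefix of U_J,
-- which is also read across the end of one U_n block and the start of the next.
window-across : ∀ J {q n} → n ≤ J → q < period J → period J < q + n →
                SameWindow (u (suc J)) q (Uω n) (period n ∸ (period J ∸ q)) n
window-across J {q} {n} n≤J q<P P<q+n =
  subst (SameWindow (u (suc J)) q (Uω n) r) (m+[n∸m]≡n (<⇒≤ s<n)) (SameWindow-++ blanks prefix)
  where
  s = period J ∸ q
  q+s : q + s ≡ period J
  q+s = m+[n∸m]≡n (<⇒≤ q<P)
  s<n : s < n
  s<n = +-cancelˡ-< q s n (subst (_< q + n) (sym q+s) P<q+n)
  r = period n ∸ s
  r+s : r + s ≡ period n
  r+s = m∸n+n≡m (<⇒≤ (<-trans s<n (m<period n)))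
  tailStart≤ : ∀ {x m} → x + s ≡ period m → n ≤ m → tailStart m ≤ x
  tailStart≤ {x} {m} x+s n≤m = +-cancelʳ-≤ m (tailStart m) x (begin
    tailStart m + m   ≡⟨ tailStart-+ m ⟩
    period m          ≡⟨ sym x+s ⟩
    x + s             ≤⟨ +-monoʳ-≤ x (≤-trans (<⇒≤ s<n) n≤m) ⟩
    x + m             ∎)
    where open ≤-Reasoning
  blanks : SameWindow (u (suc J)) q (Uω n) r s
  blanks = SameWindow-trans (SameWindow-u-suc-low J (≤-reflexive q+s))
    (SameWindow-b (u-b-block J (tailStart≤ q+s n≤J) (≤-reflexive q+s))
                  (Uω-b-block n (tailStart≤ r+s ≤-refl) (≤-reflexive r+s)))
  prefix : SameWindow (u (suc J)) (q + s) (Uω n) (r + s) (n ∸ s)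
  prefix = subst₂ (λ x y → SameWindow (u (suc J)) x (Uω n) y (n ∸ s)) (sym q+s) (sym r+s)
    (window-at-boundary J (m∸n≤m n s) n≤J)

u-window-in-Uω : ∀ n k q → q + n ≤ period (k + n) → ∃ λ r → SameWindow (u (k + n)) q (Uω n) r n
u-window-in-Uω n zero    q q+n≤P = q , window λ j j<n → sym (Uω-u n (<-≤-trans (+-monoʳ-< q j<n) q+n≤P))
u-window-in-Uω n (suc k) q q+n≤P′ with q + n ≤? period (k + n) | period (k + n) ≤? q
... | yes q+n≤P | _ = let r , w = u-window-in-Uω n k q q+n≤P in
  r , SameWindow-trans (SameWindow-u-suc-low (k + n) q+n≤P) w
... | no q+n≰P | no P≰q =
  _ , window-across (k + n) (m≤n+m n k) (≰⇒> P≰q) (≰⇒> q+n≰P)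
... | no _ | yes P≤q with q ∸ period (k + n) + n ≤? period (k + n)
...   | yes q′+n≤P = let r , w = u-window-in-Uω n k _ q′+n≤P in
  r , subst (λ x → SameWindow (u (suc (k + n))) x (Uω n) r n) (m+[n∸m]≡n P≤q)
        (SameWindow-trans (SameWindow-u-suc-high (k + n) q′+n≤P) w)
...   | no q′+n≰P = tailStart n , window-in-tail (suc (k + n)) n S≤q q+n≤P′
  where
  J = k + n
  q′ = q ∸ period J
  full : period (suc J) ≤ q + n
  full = begin
    suc (period J + period J)   ≡⟨ sym (+-suc (period J) (period J)) ⟩
    period J + suc (period J)   ≤⟨ +-monoʳ-≤ (period J) (≰⇒> q′+n≰P) ⟩
    period J + (q′ + n)         ≡⟨ sym (+-assoc (period J) q′ n) ⟩
    period J + q′ + n           ≡⟨ cong (_+ n) (m+[n∸m]≡n P≤q) ⟩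
    q + n                       ∎
    where open ≤-Reasoning
  S≤q : tailStart (suc J) ≤ q
  S≤q = +-cancelʳ-≤ (suc J) (tailStart (suc J)) q (begin
    tailStart (suc J) + suc J   ≡⟨ tailStart-+ (suc J) ⟩
    period (suc J)              ≤⟨ full ⟩
    q + n                       ≤⟨ +-monoʳ-≤ q (m≤n+m n (suc k)) ⟩
    q + suc J                   ∎)
    where open ≤-Reasoning

z-window-in-Uω : ∀ n q → ∃ λ r → SameWindow z q (Uω n) r n
z-window-in-Uω n q = let r , w = u-window-in-Uω n q q (<⇒≤ (m<period (q + n))) in
  r , SameWindow-trans (window λ j j<n → z-u (q + n) (<-≤-trans (+-monoʳ-< q j<n) (<⇒≤ (m<period (q + n))))) w

Uω-window-in-z : ∀ n p → SameWindow (Uω n) p z (p % period n) n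
Uω-window-in-z n p = window λ j j<n → let bound = in-two-periods j<n in begin
  Uω n (p + j)                  ≡⟨ Uω-shift n p (p % period n) j (sym (m%n%n≡m%n p (period n))) ⟩
  Uω n (p % period n + j)       ≡⟨ Uω-u-suc n bound ⟩
  u (suc n) (p % period n + j)  ≡⟨ sym (z-u (suc n) (<-trans bound (n<1+n _))) ⟩
  z (p % period n + j)          ∎
  where
  open ≡-Reasoning
  in-two-periods : ∀ {j} → j < n → p % period n + j < period n + period n
  in-two-periods j<n = +-mono-<-≤ (m%n<n p (period n)) (<⇒≤ (<-trans j<n (m<period n)))

factorAt : (ℕ → AB) → (n : ℕ) → ℕ → Vec AB n
factorAt f n i = tabulate (λ j → f (i + toℕ j))

factorAt-cong : ∀ {f x g y n} → SameWindow f x g y n → factorAt f n x ≡ factorAt g n y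
factorAt-cong w = tabulate-cong λ j → agree w (toℕ j) (toℕ<n j)

factorAt-window : ∀ {f x g y n} → factorAt f n x ≡ factorAt g n y → SameWindow f x g y n
factorAt-window {f} {x} {g} {y} x≡y = window λ j j<n → begin
  f (x + j)                                           ≡⟨ cong (λ t → f (x + t)) (sym (toℕ-fromℕ< j<n)) ⟩
  f (x + toℕ (fromℕ< j<n))                            ≡⟨ sym (lookup∘tabulate _ (fromℕ< j<n)) ⟩
  lookup (factorAt f _ x) (fromℕ< j<n)                ≡⟨ cong (λ v → lookup v (fromℕ< j<n)) x≡y ⟩
  lookup (factorAt g _ y) (fromℕ< j<n)                ≡⟨ lookup∘tabulate _ (fromℕ< j<n) ⟩
  g (y + toℕ (fromℕ< j<n))                            ≡⟨ cong (λ t → g (y + t)) (toℕ-fromℕ< j<n) ⟩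
  g (y + j)                                           ∎
  where open ≡-Reasoning

complexity-from-windows : ∀ f n ps → Distinct f n ps → Covering f n ps → Complexity f n (length ps)
complexity-from-windows f n ps distinct covering =
  map (factorAt f n) ps ,
  APP.map⁺ (AP.map (λ ≉ x≡y → ≉ (factorAt-window x≡y)) distinct) ,
  length-map (factorAt f n) ps ,
  λ w → mk⇔ (listed⇒factor w) (factor⇒listed w)
  where
  listed⇒factor : ∀ w → w ∈ map (factorAt f n) ps → IsFactor f n w
  listed⇒factor w w∈ with ∈-map⁻ (factorAt f n) w∈
  ... | p , _ , refl = p , lookup∘tabulate _
  factor⇒listed : ∀ w → IsFactor f n w → w ∈ map (factorAt f n) ps
  factor⇒listed w (i , w≡) = AnyP.map⁺ (Any.map (λ w′ → trans w≡f[i] (factorAt-cong w′)) (covering i))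
    where
    w≡f[i] : w ≡ factorAt f n i
    w≡f[i] = trans (sym (tabulate∘lookup w)) (tabulate-cong w≡)

theorem1 : (n : ℕ) → Complexity z n (formula n)
theorem1 n = subst (Complexity z n) (trans (length-map _ positions) count)
  (complexity-from-windows z n (map (_% period n) positions) distinct′ covering′)
  where
  open WindowReps (window-reps n n ≤-refl)
  distinct′ : Distinct z n (map (_% period n) positions)
  distinct′ = APP.map⁺ (AP.map (λ {x} {y} ≉ w → ≉ (SameWindow-trans (Uω-window-in-z n x)
                (SameWindow-trans w (SameWindow-sym (Uω-window-in-z n y))))) distinct)
  covering′ : Covering z n (map (_% period n) positions)
  covering′ t = let r , w = z-window-in-Uω n t in
    AnyP.map⁺ (Any.map (λ {p} w′ → SameWindow-trans w (SameWindow-trans w′ (Uω-window-in-z n p))) (covering r))
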